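{- Let $d,n,\alpha\in\mathbb{N}$, $L$ an arbitrary set, and $f\colon L\times\mathbb{Q}^d\to\mathbb{Q}$ an $\alpha$-$\mathbb{Z}$-linearizable function. Let $\mathcal{L}_n=\{X\subseteq L : |X|\le n\}$. Then the function $f'\colon\mathcal{L}_n\times\mathbb{Q}^d\to\mathbb{Q}$ given by (i) $f'(X,w)=\sum_{x\in X}f(x,w)$ is $n\alpha$-$\mathbb{Z}$-linearizable; (ii) $f'(X,w)=\max_{x\in X}f(x,w)$ is $2\alpha$-$\mathbb{Z}$-linearizable; (iii) $f'(X,w)=\min_{x\in X}f(x,w)$ is $2\alpha$-$\mathbb{Z}$-linearizable.
   Context: For $r\in\mathbb{N}$ let $\mathbb{Z}_r=\{\pm p : p\in\{0,\dots,r\}\}$. For $r,d\in\mathbb{N}$, two vectors $w,w'\in\mathbb{Q}^d$ are called $(r,\mathbb{Z}^d)$-equivalent if for every $\beta\in\mathbb{Z}_r^d$ with $\|\beta\|_1\le r$ one has $\mathrm{sign}(\beta^\top w)=\mathrm{sign}(\beta^\top w')$; write $[w]_r^{\mathbb{Z}^d}$ for the set of all $w'\in\mathbb{Q}^d$ that are $(r,\mathbb{Z}^d)$-equivalent to $w$. A function $f\colon L\times\mathbb{Q}^d\to\mathbb{Q}$ is $\alpha$-$\mathbb{Z}$-linearizable ($\alpha\in\mathbb{N}$) if for all $w\in\mathbb{Q}^d$ and all $x\in L$ there exists $b_{x,w}\in\mathbb{Z}_\alpha^d$ with $\|b_{x,w}\|_1\le\alpha$ such that $f(x,w')=b_{x,w}^\top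 w'$ for all $w'\in[w]_\alpha^{\mathbb{Z}^d}$. -}

module Defs where

open import Data.Nat using (ℕ; _≤_; _*_)
open import Data.Integer as ℤ using (ℤ; +_; -[1+_]; ∣_∣)
open import Data.Fin using (Fin; zero; suc)
open import Data.Rational as ℚ using (ℚ; ↥_; _⊔_; _⊓_)
open import Data.List using (List; []; _∷_; length; foldr)
open import Data.List.Relation.Unary.Unique.Propositional using (Unique)
open import Data.Product using (Σ; _×_)
open import Relation.Binary.PropositionalEquality using (_≡_)

Vecℚ : ℕ → Set
Vecℚ d = Fin d → ℚ

Vecℤ : ℕ → Set
Vecℤ d = Fin d → ℤ

dot : ∀ {d} → Vecℤ d → Vecℚ d → ℚ
dot {ℕ.zero} β w = ℚ.0ℚ
dot {ℕ.suc d} β w = ℚ._+_ (ℚ._*_ (ℚ._/_ (β zero) 1) (w zero)) (dot (λ i → β (suc i)) (λ i → w (suc i)))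

norm1 : ∀ {d} → Vecℤ d → ℕ
norm1 {ℕ.zero} β = 0
norm1 {ℕ.suc d} β = ∣ β zero ∣ Data.Nat.+ norm1 (λ i → β (suc i))

data Sgn : Set where
  neg zer pos : Sgn

sgn : ℚ → Sgn
sgn q with ↥ q
... | + ℕ.zero = zer
... | + ℕ.suc _ = pos
... | -[1+ _ ] = neg

Equiv : ∀ {d} → ℕ → Vecℚ d → Vecℚ d → Set
Equiv {d} r w w' = (β : Vecℤ d) → norm1 β ≤ r → sgn (dot β w) ≡ sgn (dot β w')

-- α-ℤ-linearizable function f : L × ℚ^d → ℚ
-- (‖b‖₁ ≤ α already forces b ∈ ℤ_α^d)
Linearizable : ∀ {d} {L : Set} → ℕ → (L → Vecℚ d → ℚ) → Set
Linearizable {d} {L} α f =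
  (w : Vecℚ d) (x : L) →
  Σ (Vecℤ d) (λ b → norm1 b ≤ α × ((w' : Vecℚ d) → Equiv α w w' → f x w' ≡ dot b w'))

record FinSub (L : Set) (n : ℕ) : Set where
  field
    elems  : List L
    unique : Unique elems
    bound  : length elems ≤ n
open FinSub public

sumℚ : List ℚ → ℚ
sumℚ = foldr ℚ._+_ ℚ.0ℚ

-- max/min over an empty set are taken to be 0 (convention)
maxℚ : List ℚ → ℚ
maxℚ [] = ℚ.0ℚ
maxℚ (q ∷ qs) = foldr _⊔_ q qs

minℚ : List ℚ → ℚ
minℚ [] = ℚ.0ℚ
minℚ (q ∷ qs) = foldr _⊓_ q qs

sumF : ∀ {d} {L : Set} {n : ℕ} → (L → Vecℚ d → ℚ) → FinSub L n → Vecℚ d → ℚ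
sumF f X w = sumℚ (Data.List.map (λ x → f x w) (elems X))

maxF : ∀ {d} {L : Set} {n : ℕ} → (L → Vecℚ d → ℚ) → FinSub L n → Vecℚ d → ℚ
maxF f X w = maxℚ (Data.List.map (λ x → f x w) (elems X))

minF : ∀ {d} {L : Set} {n : ℕ} → (L → Vecℚ d → ℚ) → FinSub L n → Vecℚ d → ℚ
minF f X w = minℚ (Data.List.map (λ x → f x w) (elems X))

-- On the class [w]_α each f x agrees with a linear form b_xᵀ· with ‖b_x‖₁ ≤ α.
-- A sum of at most n such forms is again one, of norm ≤ nα. For max (and dually
-- min), let m maximise f(·, w). For every x the test vector b_x − b_m has norm
-- ≤ 2α, so on [w]_{2α} the sign of f(x, w') − f(m, w') is the one at w; thus m
-- stays a maximiser and the maximum is b_mᵀw' throughout [w]_{2α}.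

module Submission where

open import Defs
open import Data.Nat using (ℕ; _*_)
open import Data.Product using (_×_)
open import Data.Rational using (ℚ)

open import Algebra.Construct.NaturalChoice.Base using (MaxOperator; MinOp⇒MaxOp)
import Algebra.Construct.NaturalChoice.MaxOp as MaxOp
open import Algebra.Core using (Op₂)
open import Data.Integer as ℤ using (ℤ; +_; -[1+_]; +[1+_]; ∣_∣)
import Data.Integer.Properties as ℤ
open import Data.List using ([]; _∷_; foldr; map; length)
open import Data.List.Properties using (foldr-preservesᵇ)
open import Data.List.Membership.Propositional using (_∈_)
open import Data.List.Membership.Propositional.Properties using (∈-map⁺; ∈-map⁻; foldr-selective)
open import Data.List.Relation.Unary.All as All using (All; []; _∷_)
import Data.List.Relation.Unary.All.Properties as All
open import Data.List.Relation.Unary.Any using (here; there)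
import Data.Nat as ℕ
import Data.Nat.Properties as ℕ
open import Algebra.Properties.CommutativeSemigroup ℕ.+-commutativeSemigroup using (interchange)
open import Data.Product using (Σ-syntax; ∃-syntax; _,_)
open import Data.Rational as ℚ using (mkℚ; 0ℚ; _/_; _+_; _-_; -_; _≤_; NonPositive)
import Data.Rational.Properties as ℚ
open import Data.Rational.Solver using (module +-*-Solver)
open import Data.Rational.Unnormalised as ℚᵘ using (mkℚᵘ; *≡*)
import Data.Rational.Unnormalised.Properties as ℚᵘ
open import Data.Sum using (inj₁; inj₂)
open import Data.Vec.Functional using (head; tail)
open import Relation.Binary using (Rel; IsTotalPreorder; TotalPreorder)
open import Relation.Binary.PropositionalEquality
open import Relation.Nullary using (contradiction)

fromℚᵘ-homo-+ : ∀ p q → ℚ.fromℚᵘ (p ℚᵘ.+ q) ≡ ℚ.fromℚᵘ p + ℚ.fromℚᵘ q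
fromℚᵘ-homo-+ p q = ℚ.toℚᵘ-injective (begin-equality
  ℚ.toℚᵘ (ℚ.fromℚᵘ (p ℚᵘ.+ q))                        ≃⟨ ℚ.toℚᵘ-fromℚᵘ _ ⟩
  p ℚᵘ.+ q                                             ≃⟨ ℚᵘ.+-cong (ℚᵘ.≃-sym (ℚ.toℚᵘ-fromℚᵘ p)) (ℚᵘ.≃-sym (ℚ.toℚᵘ-fromℚᵘ q)) ⟩
  ℚ.toℚᵘ (ℚ.fromℚᵘ p) ℚᵘ.+ ℚ.toℚᵘ (ℚ.fromℚᵘ q)        ≃⟨ ℚ.toℚᵘ-homo-+ (ℚ.fromℚᵘ p) (ℚ.fromℚᵘ q) ⟨
  ℚ.toℚᵘ (ℚ.fromℚᵘ p + ℚ.fromℚᵘ q)                    ∎)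
  where open ℚᵘ.≤-Reasoning

fromℚᵘ-homo‿- : ∀ p → ℚ.fromℚᵘ (ℚᵘ.- p) ≡ - ℚ.fromℚᵘ p
fromℚᵘ-homo‿- p = ℚ.toℚᵘ-injective (begin-equality
  ℚ.toℚᵘ (ℚ.fromℚᵘ (ℚᵘ.- p))   ≃⟨ ℚ.toℚᵘ-fromℚᵘ _ ⟩
  ℚᵘ.- p                       ≃⟨ ℚᵘ.-‿cong (ℚᵘ.≃-sym (ℚ.toℚᵘ-fromℚᵘ p)) ⟩
  ℚᵘ.- ℚ.toℚᵘ (ℚ.fromℚᵘ p)     ≃⟨ ℚ.toℚᵘ-homo‿- (ℚ.fromℚᵘ p) ⟨
  ℚ.toℚᵘ (- ℚ.fromℚᵘ p)        ∎)
  where open ℚᵘ.≤-Reasoning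

-- The integer coefficients of dot enter as i / 1, which is ℚ.fromℚᵘ (mkℚᵘ i 0).
/1-homo-+ : ∀ i j → (i ℤ.+ j) / 1 ≡ i / 1 + j / 1
/1-homo-+ i j = begin
  (i ℤ.+ j) / 1                        ≡⟨ ℚ.fromℚᵘ-cong mkℚᵘ-+ ⟩
  ℚ.fromℚᵘ (mkℚᵘ i 0 ℚᵘ.+ mkℚᵘ j 0)   ≡⟨ fromℚᵘ-homo-+ (mkℚᵘ i 0) (mkℚᵘ j 0) ⟩
  i / 1 + j / 1                        ∎
  where
  open ≡-Reasoning
  mkℚᵘ-+ : mkℚᵘ (i ℤ.+ j) 0 ℚᵘ.≃ mkℚᵘ i 0 ℚᵘ.+ mkℚᵘ j 0
  mkℚᵘ-+ = *≡* (cong (ℤ._* + 1) (sym (cong₂ ℤ._+_ (ℤ.*-identityʳ i) (ℤ.*-identityʳ j))))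

/1-homo‿- : ∀ i → (ℤ.- i) / 1 ≡ - (i / 1)
/1-homo‿- i = fromℚᵘ-homo‿- (mkℚᵘ i 0)

p≤q⇒p-q≤0 : ∀ {p q} → p ≤ q → p - q ≤ 0ℚ
p≤q⇒p-q≤0 {p} {q} p≤q = begin
  p - q  ≤⟨ ℚ.+-monoˡ-≤ (- q) p≤q ⟩
  q - q  ≡⟨ ℚ.+-inverseʳ q ⟩
  0ℚ     ∎
  where open ℚ.≤-Reasoning

p-q≤0⇒p≤q : ∀ {p q} → p - q ≤ 0ℚ → p ≤ q
p-q≤0⇒p≤q {p} {q} p-q≤0 = begin
  p              ≡⟨ ℚ.+-identityʳ p ⟨
  p + 0ℚ         ≡⟨ cong (λ r → p + r) (ℚ.+-inverseˡ q) ⟨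
  p + (- q + q)  ≡⟨ ℚ.+-assoc p (- q) q ⟨
  (p - q) + q    ≤⟨ ℚ.+-monoˡ-≤ q p-q≤0 ⟩
  0ℚ + q         ≡⟨ ℚ.+-identityˡ q ⟩
  q              ∎
  where open ℚ.≤-Reasoning

nonPositive⇒sgn≢pos : ∀ p → NonPositive p → sgn p ≢ pos
nonPositive⇒sgn≢pos (mkℚ (+ 0)    _ _) _ ()
nonPositive⇒sgn≢pos (mkℚ -[1+ _ ] _ _) _ ()

sgn≢pos⇒nonPositive : ∀ p → sgn p ≢ pos → NonPositive p
sgn≢pos⇒nonPositive (mkℚ (+ 0)    _ _) _ = _
sgn≢pos⇒nonPositive (mkℚ +[1+ _ ] _ _) p≢pos = contradiction refl p≢pos
sgn≢pos⇒nonPositive (mkℚ -[1+ _ ] _ _) _ = _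

sgn-≡⇒≤0 : ∀ {p q} → sgn p ≡ sgn q → p ≤ 0ℚ → q ≤ 0ℚ
sgn-≡⇒≤0 {p} {q} sgn≡ p≤0 = ℚ.nonPositive⁻¹ q {{sgn≢pos⇒nonPositive q q≢pos}}
  where
  q≢pos : sgn q ≢ pos
  q≢pos q-pos = nonPositive⇒sgn≢pos p (ℚ.nonPositive p≤0) (trans sgn≡ q-pos)

0ᵥ : ∀ {d} → Vecℤ d
0ᵥ _ = + 0

_+ᵥ_ _-ᵥ_ : ∀ {d} → Vecℤ d → Vecℤ d → Vecℤ d
(b +ᵥ c) k = b k ℤ.+ c k
(b -ᵥ c) k = b k ℤ.- c k

norm1-0ᵥ : ∀ d → norm1 (0ᵥ {d}) ≡ 0
norm1-0ᵥ ℕ.zero    = refl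
norm1-0ᵥ (ℕ.suc d) = norm1-0ᵥ d

norm1-pointwise : (_∙_ : Op₂ ℤ) → (∀ i j → ∣ i ∙ j ∣ ℕ.≤ ∣ i ∣ ℕ.+ ∣ j ∣) →
                  ∀ {d} (b c : Vecℤ d) → norm1 (λ k → b k ∙ c k) ℕ.≤ norm1 b ℕ.+ norm1 c
norm1-pointwise _∙_ ∣∙∣≤ {ℕ.zero}  b c = ℕ.z≤n
norm1-pointwise _∙_ ∣∙∣≤ {ℕ.suc d} b c = begin
  ∣ head b ∙ head c ∣ ℕ.+ norm1 (λ k → tail b k ∙ tail c k)
    ≤⟨ ℕ.+-mono-≤ (∣∙∣≤ (head b) (head c)) (norm1-pointwise _∙_ ∣∙∣≤ (tail b) (tail c)) ⟩
  (∣ head b ∣ ℕ.+ ∣ head c ∣) ℕ.+ (norm1 (tail b) ℕ.+ norm1 (tail c))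
    ≡⟨ interchange ∣ head b ∣ ∣ head c ∣ (norm1 (tail b)) (norm1 (tail c)) ⟩
  (∣ head b ∣ ℕ.+ norm1 (tail b)) ℕ.+ (∣ head c ∣ ℕ.+ norm1 (tail c))
    ∎
  where open ℕ.≤-Reasoning

norm1-+ᵥ : ∀ {d} (b c : Vecℤ d) → norm1 (b +ᵥ c) ℕ.≤ norm1 b ℕ.+ norm1 c
norm1-+ᵥ = norm1-pointwise ℤ._+_ ℤ.∣i+j∣≤∣i∣+∣j∣

norm1--ᵥ : ∀ {d} (b c : Vecℤ d) → norm1 (b -ᵥ c) ℕ.≤ norm1 b ℕ.+ norm1 c
norm1--ᵥ = norm1-pointwise ℤ._-_ ℤ.∣i-j∣≤∣i∣+∣j∣

dot-0ᵥ : ∀ {d} (w : Vecℚ d) → dot 0ᵥ w ≡ 0ℚ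
dot-0ᵥ {ℕ.zero}  w = refl
dot-0ᵥ {ℕ.suc d} w = cong₂ _+_ (ℚ.*-zeroˡ (head w)) (dot-0ᵥ (tail w))

dot-+ᵥ : ∀ {d} (b c : Vecℤ d) (w : Vecℚ d) → dot (b +ᵥ c) w ≡ dot b w + dot c w
dot-+ᵥ {ℕ.zero}  b c w = refl
dot-+ᵥ {ℕ.suc d} b c w = trans
  (cong₂ (λ p r → p ℚ.* head w + r) (/1-homo-+ (head b) (head c)) (dot-+ᵥ (tail b) (tail c) (tail w)))
  (rearrange (head b / 1) (head c / 1) (head w) (dot (tail b) (tail w)) (dot (tail c) (tail w)))
  where
  open +-*-Solver
  rearrange : ∀ p q x r s → (p + q) ℚ.* x + (r + s) ≡ (p ℚ.* x + r) + (q ℚ.* x + s)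
  rearrange = solve 5 (λ p q x r s → (p :+ q) :* x :+ (r :+ s) := (p :* x :+ r) :+ (q :* x :+ s)) refl

dot--ᵥ : ∀ {d} (b c : Vecℤ d) (w : Vecℚ d) → dot (b -ᵥ c) w ≡ dot b w - dot c w
dot--ᵥ {ℕ.zero}  b c w = refl
dot--ᵥ {ℕ.suc d} b c w = trans
  (cong₂ (λ p r → p ℚ.* head w + r) /1-homo-- (dot--ᵥ (tail b) (tail c) (tail w)))
  (rearrange (head b / 1) (head c / 1) (head w) (dot (tail b) (tail w)) (dot (tail c) (tail w)))
  where
  /1-homo-- : (head b ℤ.- head c) / 1 ≡ head b / 1 - head c / 1
  /1-homo-- = trans (/1-homo-+ (head b) (ℤ.- head c)) (cong (λ r → head b / 1 + r) (/1-homo‿- (head c)))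
  open +-*-Solver
  rearrange : ∀ p q x r s → (p - q) ℚ.* x + (r - s) ≡ (p ℚ.* x + r) - (q ℚ.* x + s)
  rearrange = solve 5 (λ p q x r s → (p :- q) :* x :+ (r :- s) := (p :* x :+ r) :- (q :* x :+ s)) refl

Equiv-mono : ∀ {d r s} {w w' : Vecℚ d} → r ℕ.≤ s → Equiv s w w' → Equiv r w w'
Equiv-mono r≤s w~w' β ∣β∣≤r = w~w' β (ℕ.≤-trans ∣β∣≤r r≤s)

-- Linearizable α f unfolds to ∀ w x → LinearOnClass α w (f x).
LinearOnClass : ∀ {d} → ℕ → Vecℚ d → (Vecℚ d → ℚ) → Set
LinearOnClass {d} r w g = Σ[ b ∈ Vecℤ d ] norm1 b ℕ.≤ r × ((w' : Vecℚ d) → Equiv r w w' → g w' ≡ dot b w')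

module _ {d : ℕ} {w : Vecℚ d} where

  LinearOnClass-0 : ∀ {r} → LinearOnClass r w (λ _ → 0ℚ)
  LinearOnClass-0 = 0ᵥ , ℕ.≤-trans (ℕ.≤-reflexive (norm1-0ᵥ d)) ℕ.z≤n , λ w' _ → sym (dot-0ᵥ w')

  LinearOnClass-agree : ∀ {r s} {g h : Vecℚ d → ℚ} → r ℕ.≤ s → LinearOnClass r w g →
                        (∀ w' → Equiv s w w' → h w' ≡ g w') → LinearOnClass s w h
  LinearOnClass-agree r≤s (b , ∣b∣≤r , g≡b) h≡g =
    b , ℕ.≤-trans ∣b∣≤r r≤s , λ w' w~w' → trans (h≡g w' w~w') (g≡b w' (Equiv-mono r≤s w~w'))

  LinearOnClass-mono : ∀ {r s} {g : Vecℚ d → ℚ} → r ℕ.≤ s → LinearOnClass r w g → LinearOnClass s w g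
  LinearOnClass-mono r≤s lin = LinearOnClass-agree r≤s lin (λ _ _ → refl)

  LinearOnClass-+ : ∀ {r s} {g h : Vecℚ d → ℚ} → LinearOnClass r w g → LinearOnClass s w h →
                    LinearOnClass (r ℕ.+ s) w (λ w' → g w' + h w')
  LinearOnClass-+ {r} {s} (b , ∣b∣≤r , g≡b) (c , ∣c∣≤s , h≡c) =
    b +ᵥ c , ℕ.≤-trans (norm1-+ᵥ b c) (ℕ.+-mono-≤ ∣b∣≤r ∣c∣≤s) , λ w' w~w' →
      trans (cong₂ _+_ (g≡b w' (Equiv-mono (ℕ.m≤m+n r s) w~w')) (h≡c w' (Equiv-mono (ℕ.m≤n+m s r) w~w')))
            (sym (dot-+ᵥ b c w'))

  -- The difference of the two linear forms is a test vector of norm ≤ r + s,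
  -- so the sign of g − h is constant on [w]_{r+s}.
  LinearOnClass-≤ : ∀ {r s} {g h : Vecℚ d → ℚ} → LinearOnClass r w g → LinearOnClass s w h →
                    g w ≤ h w → ∀ {w'} → Equiv (r ℕ.+ s) w w' → g w' ≤ h w'
  LinearOnClass-≤ {r} {s} {g} {h} (b , ∣b∣≤r , g≡b) (c , ∣c∣≤s , h≡c) gw≤hw {w'} w~w' =
    p-q≤0⇒p≤q (subst (_≤ 0ℚ) (difference w' w~w')
      (sgn-≡⇒≤0 (w~w' (b -ᵥ c) ∣b-c∣≤r+s) (subst (_≤ 0ℚ) (sym (difference w (λ _ _ → refl))) (p≤q⇒p-q≤0 gw≤hw))))
    where
    ∣b-c∣≤r+s : norm1 (b -ᵥ c) ℕ.≤ r ℕ.+ s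
    ∣b-c∣≤r+s = ℕ.≤-trans (norm1--ᵥ b c) (ℕ.+-mono-≤ ∣b∣≤r ∣c∣≤s)
    difference : ∀ v → Equiv (r ℕ.+ s) w v → dot (b -ᵥ c) v ≡ g v - h v
    difference v w~v = trans (dot--ᵥ b c v)
      (sym (cong₂ _-_ (g≡b v (Equiv-mono (ℕ.m≤m+n r s) w~v)) (h≡c v (Equiv-mono (ℕ.m≤n+m s r) w~v))))

≡-totalPreorder : ∀ {a ℓ} {A : Set a} {_≲_ : Rel A ℓ} → IsTotalPreorder _≡_ _≲_ → TotalPreorder a a ℓ
≡-totalPreorder isTotalPreorder = record { isTotalPreorder = isTotalPreorder }

module FoldrMax {a ℓ} {A : Set a} {_≲_ : Rel A ℓ} {isTotalPreorder : IsTotalPreorder _≡_ _≲_}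
                (maxOp : MaxOperator (≡-totalPreorder isTotalPreorder)) where

  open IsTotalPreorder isTotalPreorder using () renaming (refl to ≲-refl; trans to ≲-trans)
  open MaxOperator maxOp using (_⊔_; x≤y⇒x⊔y≈y; x≥y⇒x⊔y≈x)
  open MaxOp maxOp using (⊔-sel; ⊔-lub; x≤x⊔y; x≤y⊔x)

  ≲-antisym : ∀ {x y} → x ≲ y → y ≲ x → x ≡ y
  ≲-antisym x≲y y≲x = trans (sym (x≥y⇒x⊔y≈x y≲x)) (x≤y⇒x⊔y≈y x≲y)

  foldr-⊔-∈ : ∀ e xs → foldr _⊔_ e xs ∈ e ∷ xs
  foldr-⊔-∈ e xs with foldr-selective ⊔-sel e xs
  ... | inj₁ ≡e = here ≡e
  ... | inj₂ ∈xs = there ∈xs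

  foldr-⊔-upper : ∀ e xs → All (_≲ foldr _⊔_ e xs) (e ∷ xs)
  foldr-⊔-upper e [] = ≲-refl ∷ []
  foldr-⊔-upper e (x ∷ xs) with foldr-⊔-upper e xs
  ... | e≲ ∷ xs≲ = ≲-trans e≲ (x≤y⊔x x _) ∷ x≤x⊔y x _ ∷ All.map (λ y≲ → ≲-trans y≲ (x≤y⊔x x _)) xs≲

  foldr-⊔-least : ∀ {c e xs} → All (_≲ c) (e ∷ xs) → foldr _⊔_ e xs ≲ c
  foldr-⊔-least (e≲c ∷ xs≲c) = foldr-preservesᵇ ⊔-lub e≲c xs≲c

  module _ {b} {B : Set b} (g : B → A) where

    argmax : ∀ x xs → ∃[ m ] m ∈ x ∷ xs × All (λ y → g y ≲ g m) (x ∷ xs)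
    argmax x xs with ∈-map⁻ g (foldr-⊔-∈ (g x) (map g xs))
    ... | m , m∈ , max≡gm =
      m , m∈ , All.map⁻ (subst (λ c → All (_≲ c) (map g (x ∷ xs))) max≡gm (foldr-⊔-upper (g x) (map g xs)))

    foldr-⊔-map-argmax : ∀ {m x xs} → m ∈ x ∷ xs → All (λ y → g y ≲ g m) (x ∷ xs) →
                         foldr _⊔_ (g x) (map g xs) ≡ g m
    foldr-⊔-map-argmax {x = x} {xs} m∈ ≲gm = ≲-antisym
      (foldr-⊔-least (All.map⁺ ≲gm))
      (All.lookup (foldr-⊔-upper (g x) (map g xs)) (∈-map⁺ g m∈))

module Max = FoldrMax ℚ.⊔-operator
module Min = FoldrMax (MinOp⇒MaxOp ℚ.⊓-operator)

module _ {d} {L : Set} {r : ℕ} {w : Vecℚ d} {f : L → Vecℚ d → ℚ} (lin : ∀ x → LinearOnClass r w (f x)) where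

  sumℚ-LinearOnClass : ∀ xs → LinearOnClass (length xs ℕ.* r) w (λ w' → sumℚ (map (λ x → f x w') xs))
  sumℚ-LinearOnClass []       = LinearOnClass-0
  sumℚ-LinearOnClass (x ∷ xs) = LinearOnClass-+ (lin x) (sumℚ-LinearOnClass xs)

  maxℚ-LinearOnClass : ∀ xs → LinearOnClass (r ℕ.+ r) w (λ w' → maxℚ (map (λ x → f x w') xs))
  maxℚ-LinearOnClass []       = LinearOnClass-0
  maxℚ-LinearOnClass (x ∷ xs) with Max.argmax (λ y → f y w) x xs
  ... | m , m∈ , fm-max = LinearOnClass-agree (ℕ.m≤m+n r r) (lin m) λ w' w~w' →
    Max.foldr-⊔-map-argmax (λ y → f y w') m∈
      (All.map (λ {y} fy≤fm → LinearOnClass-≤ (lin y) (lin m) fy≤fm w~w') fm-max)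

  minℚ-LinearOnClass : ∀ xs → LinearOnClass (r ℕ.+ r) w (λ w' → minℚ (map (λ x → f x w') xs))
  minℚ-LinearOnClass []       = LinearOnClass-0
  minℚ-LinearOnClass (x ∷ xs) with Min.argmax (λ y → f y w) x xs
  ... | m , m∈ , fm-min = LinearOnClass-agree (ℕ.m≤m+n r r) (lin m) λ w' w~w' →
    Min.foldr-⊔-map-argmax (λ y → f y w') m∈
      (All.map (λ {y} fm≤fy → LinearOnClass-≤ (lin m) (lin y) fm≤fy w~w') fm-min)

lemma20 : (d n α : ℕ) (L : Set) (f : L → Vecℚ d → ℚ) →
    Linearizable α f →
    Linearizable (n * α) (sumF {d} {L} {n} f)
    × Linearizable (2 * α) (maxF {d} {L} {n} f)
    × Linearizable (2 * α) (minF {d} {L} {n} f)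
lemma20 d n α L f lin =
  (λ w X → LinearOnClass-mono (ℕ.*-monoˡ-≤ α (bound X)) (sumℚ-LinearOnClass (lin w) (elems X))) ,
  (λ w X → LinearOnClass-mono α+α≤2α (maxℚ-LinearOnClass (lin w) (elems X))) ,
  (λ w X → LinearOnClass-mono α+α≤2α (minℚ-LinearOnClass (lin w) (elems X)))
  where
  α+α≤2α : α ℕ.+ α ℕ.≤ 2 * α
  α+α≤2α = ℕ.≤-reflexive (cong (α ℕ.+_) (sym (ℕ.+-identityʳ α)))
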